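{- Let $\pi_1^*=(u_1,\dots,u_l)$ be a directed path in $G_1^*$ from $v_\alpha$ to $v_\beta$ with the minimum number of color-switches, let $j^1<\dots<j^\lambda$ be the indices of its color-switching vertices, set $j^0=1$, and for $0\le h\le\lambda$ let $z^h$ be the color of the edges of $\pi_1^*$ between $u_{j^h}$ and $u_{j^{h+1}}$ (with $j^{\lambda+1}=l$). Then for any $0\le x,y\le\lambda$ with $|x-y|\ge2$, the components $\mathrm{comp}(u_{j^x},z^x)$ and $\mathrm{comp}(u_{j^y},z^y)$ have no common vertex.
   Context: Pairwise disjoint finite sets $P_1,\dots,P_\ell$ ($\ell\ge2$) with equal sizes, a metric $d$ on $\Omega=\bigcup_iP_i$, integer $k>0$. A balanced clustering partitions $\Omega$ into at most $k$ clusters $X$ with $|X\cap P_1|=\dots=|X\cap P_\ell|$; optimal means minimum sum of radii $r(Q)=\min_{p\in\Omega}\max_{q\in Q}d(p,q)$. For $2\le i\le\ell$, $M_i$ is a minimum-weight perfect matching between $P_1$ and $P_i$ (weights $d$), $M=\bigcup_iM_i$. Fix an optimal balanced clustering $\mathcal C^*$ and merge: while an edge of $M$ joins two different current clusters, replace them by their union. Let $\hat C$ be one resulting cluster and $C_1^*,\dots,C_\tau^*$ the clusters of $\mathcal C^*$ whose union is $\hat C$. The directed multigraph $G_1^*$ has a vertex $v_j$ for each $C_j^*$; for each $\{p,q\}\in M$ with $p\in P_1\cap C_i^*$, $q\in P_z\cap C_j^*$, $i\ne j$, there is a $0$-edge of color $z$ from $v_i$ to $v_j$, and for each $\{p,q\}\in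 M$ with $p\in P_z\cap C_i^*$, $q\in P_1\cap C_j^*$ a $1$-edge of color $z$ from $v_i$ to $v_j$. $G_z^*$ is the subgraph of $G_1^*$ formed by the edges of color $z$, and $\mathrm{comp}(v,z)$ denotes the connected component of $G_z^*$ containing $v$. A directed path is a sequence of distinct vertices with a chosen edge between consecutive ones; two consecutive edges form a color-switch if their colors differ, and the common vertex is then a color-switching vertex. -}

module Defs where

open import Level using (Level; 0ℓ) renaming (suc to lsuc)
open import Data.Nat using (ℕ; zero; suc; _≤_; _<_; _∸_)
open import Data.Fin using (Fin; zero; suc)
open import Data.Fin.Properties using () renaming (_≟_ to _≟F_)
open import Data.Fin.Permutation using (Permutation′; _⟨$⟩ʳ_)
open import Data.Bool using (Bool; true; false)
open import Data.Product using (Σ; ∃; ∃-syntax; _×_; _,_; proj₁; proj₂)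
open import Data.Sum using (_⊎_)
open import Data.List using (List; []; _∷_; _++_; length; filter; map; upTo; allFin)
open import Relation.Nullary using (¬_; ¬?)
open import Relation.Binary.PropositionalEquality using (_≡_; _≢_)
open import Relation.Binary.Construct.Closure.ReflexiveTransitive using (Star)
open import Algebra.Structures using (IsCommutativeMonoid)
open import Relation.Binary.Structures using (IsTotalOrder)

-- The paper uses ℝ≥0 with + and ≤;
-- ℝ is not available, so we allow any totally ordered commutative monoid
-- whose addition is monotone (ℝ with +, 0, ≤ is an instance).

record DistanceDomain : Set₁ where
  field
    Carrier  : Set
    _+_      : Carrier → Carrier → Carrier
    0#       : Carrier
    _≤ᵈ_     : Carrier → Carrier → Set
    isCommutativeMonoid : IsCommutativeMonoid _≡_ _+_ 0#
    isTotalOrder        : IsTotalOrder _≡_ _≤ᵈ_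
    +-mono   : ∀ {a b c} → a ≤ᵈ b → (a + c) ≤ᵈ (b + c)

module _ (D : DistanceDomain) where
  open DistanceDomain D

  sumFin : (n : ℕ) → (Fin n → Carrier) → Carrier
  sumFin zero    f = 0#
  sumFin (suc n) f = f zero + sumFin n (λ i → f (suc i))

-- Below the parameter ℓ means: the number of sets is suc ℓ
-- (so that P_1 = colour zero exists).  P_{i+1} is represented by colour
-- index i : Fin (suc ℓ); all P_i have the same size n and are pairwise
-- disjoint, so Ω = ⋃ P_i is represented by Fin (suc ℓ) × Fin n, and
-- (i , a) ∈ P_{i+1}.

Point : ℕ → ℕ → Set
Point ℓ n = Fin (suc ℓ) × Fin n

module _ (D : DistanceDomain) where
  open DistanceDomain D

  record IsMetric {A : Set} (d : A → A → Carrier) : Set where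
    field
      nonneg   : ∀ p q → 0# ≤ᵈ d p q
      zero⇔eq  : ∀ p q → (d p q ≡ 0# → p ≡ q) × (p ≡ q → d p q ≡ 0#)
      symm     : ∀ p q → d p q ≡ d q p
      triangle : ∀ p q r → d p r ≤ᵈ (d p q + d q r)

-- Clusterings.  A clustering of Ω into m clusters is a labelling
-- cl : Ω → Fin m; cluster c is { p | cl p ≡ c }.  All clusters are
-- nonempty (cl surjective).

module _ {ℓ n : ℕ} where

  countIn : {m : ℕ} → (Point ℓ n → Fin m) → Fin m → Fin (suc ℓ) → ℕ
  countIn cl c i = length (filter (λ a → cl (i , a) ≟F c) (allFin n))

  record BalancedClustering (k : ℕ) : Set where
    field
      m        : ℕ
      atMostK  : m ≤ k
      cl       : Point ℓ n → Fin m
      nonempty : ∀ c → ∃[ p ] cl p ≡ c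
      balanced : ∀ c i j → countIn cl c i ≡ countIn cl c j

module _ (D : DistanceDomain) {ℓ n : ℕ} (d : Point ℓ n → Point ℓ n → DistanceDomain.Carrier D) where
  open DistanceDomain D

  -- r is the radius r(Q) = min_{p ∈ Ω} max_{q ∈ Q} d(p,q) of the
  -- (nonempty) set Q ⊆ Ω given as a predicate (D is totally ordered):
  -- some centre p has max_{q∈Q} d(p,q) ≤ r, and every p has
  -- max_{q∈Q} d(p,q) ≥ r.
  IsRadius : (Point ℓ n → Set) → Carrier → Set
  IsRadius Q r = (∃[ p ] (∀ q → Q q → d p q ≤ᵈ r))
               × (∀ p → ∃[ q ] (Q q × r ≤ᵈ d p q))

  AreRadii : ∀ {k} (C : BalancedClustering {ℓ} {n} k)
             → (Fin (BalancedClustering.m C) → Carrier) → Set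
  AreRadii C ρ = ∀ c → IsRadius (λ p → BalancedClustering.cl C p ≡ c) (ρ c)

  IsOptimal : ∀ {k} → BalancedClustering {ℓ} {n} k → Set
  IsOptimal {k} C =
    Σ (Fin (BalancedClustering.m C) → Carrier) λ ρ → AreRadii C ρ ×
      (∀ (C' : BalancedClustering {ℓ} {n} k) ρ' → AreRadii C' ρ' →
        sumFin D _ ρ ≤ᵈ sumFin D _ ρ')

  -- σ i (for i ≠ 0, i.e. P_{i+1} with 2 ≤ i+1 ≤ ℓ) is a minimum-weight
  -- perfect matching M_{i+1} between P_1 and P_{i+1}: (zero , a) is
  -- matched with (i , σ i ⟨$⟩ʳ a).
  IsMinMatching : (Fin (suc ℓ) → Permutation′ n) → Set
  IsMinMatching σ = ∀ (i : Fin (suc ℓ)) → i ≢ zero → ∀ (τ : Permutation′ n) →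
    sumFin D n (λ a → d (zero , a) (i , σ i ⟨$⟩ʳ a))
      ≤ᵈ sumFin D n (λ a → d (zero , a) (i , τ ⟨$⟩ʳ a))


module Graph {ℓ n m : ℕ} (σ : Fin (suc ℓ) → Permutation′ n) (cl : Point ℓ n → Fin m) where

  p₁ : Fin n → Point ℓ n
  p₁ a = (zero , a)
  q₁ : Fin (suc ℓ) → Fin n → Point ℓ n
  q₁ z a = (z , σ z ⟨$⟩ʳ a)

  Linked : Fin m → Fin m → Set
  Linked c c' = ∃[ z ] (z ≢ zero × ∃[ a ]
     ((cl (p₁ a) ≡ c × cl (q₁ z a) ≡ c') ⊎ (cl (q₁ z a) ≡ c × cl (p₁ a) ≡ c')))

  -- c' ends up in the same merged cluster as c (the merging process
  -- terminates with the connected components of Linked)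
  Merged : Fin m → Fin m → Set
  Merged = Star Linked

  -- Edges of the multigraph: one potential 0-edge and one potential
  -- 1-edge per matching edge (z , a).  kind false = 0-edge, true = 1-edge.
  record Edge : Set where
    constructor edge
    field
      colour : Fin (suc ℓ)
      elt    : Fin n
      kind   : Bool

  src tgt : Edge → Fin m
  src (edge z a false) = cl (p₁ a)
  src (edge z a true)  = cl (q₁ z a)
  tgt (edge z a false) = cl (q₁ z a)
  tgt (edge z a true)  = cl (p₁ a)

  -- Ĉ is represented by a cluster ĉ of C* lying in it; the vertices of
  -- G_1^* are the clusters c of C* with Merged ĉ c.
  module _ (ĉ : Fin m) where

    Vertex : Fin m → Set
    Vertex c = Merged ĉ c

    IsEdge : Edge → Set
    IsEdge e = Edge.colour e ≢ zero × Vertex (src e) × Vertex (tgt e)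
             × (Edge.kind e ≡ false → src e ≢ tgt e)

    AdjIn : Fin (suc ℓ) → Fin m → Fin m → Set
    AdjIn z c c' = ∃[ e ] (IsEdge e × Edge.colour e ≡ z ×
                     ((src e ≡ c × tgt e ≡ c') ⊎ (src e ≡ c' × tgt e ≡ c)))

    InComp : Fin m → Fin (suc ℓ) → Fin m → Set
    InComp v z w = Vertex v × Star (AdjIn z) v w

    -- A directed path (u 0 , … , u L) with edges e 0 , … , e (L-1),
    -- e i from u i to u (i+1); vertices pairwise distinct.
    -- (0-based: u i is the paper's u_{i+1}, and l = L + 1.)
    record Path (α β : Fin m) : Set where
      field
        L      : ℕ
        u      : ℕ → Fin m
        e      : ℕ → Edge
        start  : u 0 ≡ α
        end    : u L ≡ β
        vert   : ∀ i → i ≤ L → Vertex (u i)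
        edges  : ∀ i → i < L → IsEdge (e i) × src (e i) ≡ u i × tgt (e i) ≡ u (suc i)
        distinct : ∀ i j → i ≤ L → j ≤ L → u i ≡ u j → i ≡ j

    module _ {α β : Fin m} (π : Path α β) where
      open Path π

      col : ℕ → Fin (suc ℓ)
      col i = Edge.colour (e i)

      -- indices (0-based) of the colour-switching vertices, increasing:
      -- vertex u (suc t) is colour-switching iff col t ≢ col (suc t),
      -- for t + 1 < L.
      switchIdx : List ℕ
      switchIdx = map suc (filter (λ t → ¬? (col t ≟F col (suc t))) (upTo (L ∸ 1)))

      switches : ℕ
      switches = length switchIdx

      -- the sequence j^0 = start, j^1 < … < j^λ, j^{λ+1} = end
      -- (0-based vertex indices)
      jSeq : List ℕ
      jSeq = 0 ∷ (switchIdx ++ (L ∷ []))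

    MinSwitch : ∀ {α β} → Path α β → Set
    MinSwitch {α} {β} π = ∀ (π' : Path α β) → switches π ≤ switches π'

-- h-th entry of a list of naturals (default 0 beyond the end)
nth : List ℕ → ℕ → ℕ
nth []       _       = 0
nth (x ∷ xs) zero    = x
nth (x ∷ xs) (suc h) = nth xs h

{-# OPTIONS --safe #-}
module Submission where

-- If comp(u_{j^x}, z^x) and comp(u_{j^y}, z^y) shared a vertex w with x + 2 ≤ y, follow π to
-- u_{j^x}, walk inside the first component to w and inside the second one on to u_{j^y}, then
-- follow π to its end. Every matching edge gives edges of G_1^* in both directions, so these
-- component walks can be taken directed and monochromatic. Between u_{j^x} and u_{j^y} the detour
-- changes colour at most once, whereas π switches at u_{j^{x+1}} and at u_{j^y}; cutting the cycles
-- out of the detour adds no switches, so it yields an α–β path with fewer switches than π.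

open import Defs
open import Level using (Level)
open import Function using (_∘_; id)
open import Data.Nat using (ℕ; zero; suc; _≤_; _<_; _+_; _∸_; z≤n; s≤s)
open import Data.Nat.Properties
open import Data.Fin using (Fin)
open import Data.Fin.Properties using () renaming (_≟_ to _≟F_)
open import Data.Fin.Permutation using (Permutation′)
open import Data.Bool using (true; false; not)
open import Data.List using (List; []; _∷_; _++_; [_]; length; map; filter; applyUpTo; upTo)
open import Data.List.Properties using (length-map; map-++; map-upTo; map-applyUpTo; applyUpTo-∷ʳ)
open import Data.List.Membership.Propositional using (_∈_)
open import Data.List.Membership.Propositional.Properties using (∈-filter⁻; ∈-upTo⁻)
open import Data.List.Relation.Unary.Any using (here; there)
open import Data.List.Relation.Unary.All using (All; []; _∷_)
import Data.List.Relation.Unary.All as All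
open import Data.List.Relation.Unary.All.Properties using (¬Any⇒All¬)
open import Data.List.Relation.Unary.AllPairs using (AllPairs; []; _∷_)
import Data.List.Relation.Unary.AllPairs.Properties as AllPairs
open import Data.List.Relation.Unary.Unique.Propositional using (Unique)
open import Data.List.Relation.Binary.Sublist.Propositional using (_⊆_; []; _∷_; _∷ʳ_; ⊆-refl; ⊆-trans)
import Data.List.Relation.Binary.Sublist.Propositional.Properties as Sublist
open import Data.Product using (Σ; ∃-syntax; _×_; _,_; proj₁; proj₂)
open import Data.Sum using (_⊎_; inj₁; inj₂; swap)
open import Relation.Nullary using (¬_; yes; no; ¬?; contradiction)
open import Relation.Unary using (Pred; Decidable)
open import Relation.Binary using (Rel; DecidableEquality; Symmetric)
open import Relation.Binary.PropositionalEquality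
  using (_≡_; _≢_; refl; sym; trans; cong; cong₂; subst; module ≡-Reasoning)
open import Relation.Binary.Construct.Closure.ReflexiveTransitive using (Star; ε; _◅_)
import Relation.Binary.Construct.Closure.ReflexiveTransitive as Star

lookupOr : {A : Set} → A → List A → ℕ → A
lookupOr d []       _       = d
lookupOr d (x ∷ xs) zero    = x
lookupOr d (x ∷ xs) (suc i) = lookupOr d xs i

applyUpTo-lookupOr : {A : Set} (d : A) (xs : List A) → applyUpTo (lookupOr d xs) (length xs) ≡ xs
applyUpTo-lookupOr d []       = refl
applyUpTo-lookupOr d (x ∷ xs) = cong (x ∷_) (applyUpTo-lookupOr d xs)

lookupOr-∈ : {A : Set} {d : A} {xs : List A} {i : ℕ} → i < length xs → lookupOr d xs i ∈ xs
lookupOr-∈ {xs = x ∷ xs} {zero}  _         = here refl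
lookupOr-∈ {xs = x ∷ xs} {suc i} (s≤s i<n) = there (lookupOr-∈ i<n)

lookupOr-injective : {A : Set} {d : A} {xs : List A} {i j : ℕ} → Unique xs →
  i < length xs → j < length xs → lookupOr d xs i ≡ lookupOr d xs j → i ≡ j
lookupOr-injective {xs = x ∷ xs} {zero}  {zero}  _ _ _ _ = refl
lookupOr-injective {xs = x ∷ xs} {zero}  {suc j} (x∉ ∷ _) _ (s≤s j<n) eq =
  contradiction eq (All.lookup x∉ (lookupOr-∈ j<n))
lookupOr-injective {xs = x ∷ xs} {suc i} {zero}  (x∉ ∷ _) (s≤s i<n) _ eq =
  contradiction (sym eq) (All.lookup x∉ (lookupOr-∈ i<n))
lookupOr-injective {xs = x ∷ xs} {suc i} {suc j} (_ ∷ unique) (s≤s i<n) (s≤s j<n) eq =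
  cong suc (lookupOr-injective unique i<n j<n eq)

nth-∈ : {xs : List ℕ} {i : ℕ} → i < length xs → nth xs i ∈ xs
nth-∈ {x ∷ xs} {zero}  _         = here refl
nth-∈ {x ∷ xs} {suc i} (s≤s i<n) = there (nth-∈ i<n)

nth-AllPairs : {r : Level} {R : Rel ℕ r} {xs : List ℕ} {i j : ℕ} → AllPairs R xs →
  i < j → j < length xs → R (nth xs i) (nth xs j)
nth-AllPairs {xs = x ∷ xs} {zero}  {suc j} (x~xs ∷ _) _ (s≤s j<n) = All.lookup x~xs (nth-∈ j<n)
nth-AllPairs {xs = x ∷ xs} {suc i} {suc j} (_ ∷ pairs) (s≤s i<j) (s≤s j<n) = nth-AllPairs pairs i<j j<n

nth-map-suc-++ : (xs ys : List ℕ) {i : ℕ} → i < length xs →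
  nth (map suc xs ++ ys) i ≡ suc (nth xs i)
nth-map-suc-++ (x ∷ xs) ys {zero}  _         = refl
nth-map-suc-++ (x ∷ xs) ys {suc i} (s≤s i<n) = nth-map-suc-++ xs ys i<n

nth-0∷map-suc-++-≤ : {xs : List ℕ} (ys : List ℕ) {i : ℕ} → AllPairs _<_ xs → i < length xs →
  nth (0 ∷ map suc xs ++ ys) i ≤ nth xs i
nth-0∷map-suc-++-≤ ys {zero}  _      _   = z≤n
nth-0∷map-suc-++-≤ {xs} ys {suc i} sorted i<n =
  subst (_≤ nth xs (suc i)) (sym (nth-map-suc-++ xs ys (<-trans (n<1+n i) i<n))) (nth-AllPairs sorted (n<1+n i) i<n)

length-filter-map : {A B : Set} {p : Level} {P : Pred B p} (P? : Decidable P) (g : A → B) (xs : List A) →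
  length (filter P? (map g xs)) ≡ length (filter (P? ∘ g) xs)
length-filter-map P? g []       = refl
length-filter-map P? g (x ∷ xs) with P? (g x)
... | yes _ = cong suc (length-filter-map P? g xs)
... | no  _ = length-filter-map P? g xs

module ColourChanges {A : Set} (_≟_ : DecidableEquality A) where

  change : A → A → ℕ
  change x y with x ≟ y
  ... | yes _ = 0
  ... | no  _ = 1

  change-refl : ∀ x → change x x ≡ 0
  change-refl x with x ≟ x
  ... | yes _   = refl
  ... | no  x≢x = contradiction refl x≢x

  change-≢ : ∀ {x y} → x ≢ y → change x y ≡ 1
  change-≢ {x} {y} x≢y with x ≟ y
  ... | yes x≡y = contradiction x≡y x≢y
  ... | no  _   = refl

  change≤1 : ∀ x y → change x y ≤ 1
  change≤1 x y with x ≟ y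
  ... | yes _ = z≤n
  ... | no  _ = s≤s z≤n

  change-triangle : ∀ x y z → change x z ≤ change x y + change y z
  change-triangle x y z with x ≟ y
  ... | yes refl = ≤-refl
  ... | no  _    = ≤-trans (change≤1 x z) (s≤s z≤n)

  changesFrom : A → List A → ℕ
  changesFrom c []       = 0
  changesFrom c (x ∷ xs) = change c x + changesFrom x xs

  changes : List A → ℕ
  changes []       = 0
  changes (x ∷ xs) = changesFrom x xs

  changes≤changesFrom : ∀ c xs → changes xs ≤ changesFrom c xs
  changes≤changesFrom c []       = z≤n
  changes≤changesFrom c (x ∷ xs) = m≤n+m _ _

  changesFrom-self : ∀ x xs → changesFrom x (x ∷ xs) ≡ changes (x ∷ xs)
  changesFrom-self x xs = cong (_+ changesFrom x xs) (change-refl x)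

  changesFrom-via : ∀ c y xs → changesFrom c xs ≤ change c y + changesFrom y xs
  changesFrom-via c y []       = z≤n
  changesFrom-via c y (x ∷ xs) = begin
    change c x + changesFrom x xs              ≤⟨ +-monoˡ-≤ _ (change-triangle c y x) ⟩
    change c y + change y x + changesFrom x xs ≡⟨ +-assoc (change c y) _ _ ⟩
    change c y + changesFrom y (x ∷ xs)        ∎
    where open ≤-Reasoning

  changesFrom-mono : ∀ {xs ys} → xs ⊆ ys → ∀ c → changesFrom c xs ≤ changesFrom c ys
  changesFrom-mono []             c = ≤-refl
  changesFrom-mono {xs} (y ∷ʳ xs⊆ys) c =
    ≤-trans (changesFrom-via c y xs) (+-monoʳ-≤ (change c y) (changesFrom-mono xs⊆ys y))
  changesFrom-mono (refl ∷ xs⊆ys) c = +-monoʳ-≤ _ (changesFrom-mono xs⊆ys _)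

  changesFrom-++ : ∀ c xs y ys → changesFrom c (xs ++ y ∷ ys) ≡ changesFrom c (xs ++ [ y ]) + changesFrom y ys
  changesFrom-++ c []       y ys = cong (_+ changesFrom y ys) (sym (+-identityʳ _))
  changesFrom-++ c (x ∷ xs) y ys =
    trans (cong (change c x +_) (changesFrom-++ x xs y ys)) (sym (+-assoc (change c x) _ _))

  changesFrom-constant : ∀ {c xs} ys → All (_≡ c) xs → changesFrom c (xs ++ ys) ≡ changesFrom c ys
  changesFrom-constant     ys []           = refl
  changesFrom-constant {c} {_ ∷ xs} ys (refl ∷ cs) =
    trans (cong (_+ changesFrom c (xs ++ ys)) (change-refl c)) (changesFrom-constant ys cs)

  changesFrom-detour : ∀ c ps {a b xs ys} ss → All (_≡ a) xs → All (_≡ b) ys →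
    changesFrom c (ps ++ xs ++ ys ++ ss) ≤ changesFrom c (ps ++ [ a ]) + change a b + changesFrom b ss
  changesFrom-detour c ps {a} {b} {xs} {ys} ss as bs = begin
    changesFrom c (ps ++ xs ++ ys ++ ss)
      ≤⟨ changesFrom-mono (Sublist.++⁺ (⊆-refl {x = ps}) (a ∷ʳ ⊆-refl)) c ⟩
    changesFrom c (ps ++ a ∷ xs ++ ys ++ ss)
      ≡⟨ changesFrom-++ c ps a (xs ++ ys ++ ss) ⟩
    p + changesFrom a (xs ++ ys ++ ss)
      ≡⟨ cong (p +_) (changesFrom-constant (ys ++ ss) as) ⟩
    p + changesFrom a (ys ++ ss)
      ≤⟨ +-monoʳ-≤ p (changesFrom-via a b (ys ++ ss)) ⟩
    p + (change a b + changesFrom b (ys ++ ss))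
      ≡⟨ cong (λ k → p + (change a b + k)) (changesFrom-constant ss bs) ⟩
    p + (change a b + changesFrom b ss)
      ≡⟨ +-assoc p (change a b) (changesFrom b ss) ⟨
    p + change a b + changesFrom b ss ∎
    where
      open ≤-Reasoning
      p : ℕ
      p = changesFrom c (ps ++ [ a ])

  changesUpTo : (ℕ → A) → ℕ → ℕ
  changesUpTo f n = changes (applyUpTo f (suc n))

  changesUpTo-+ : ∀ f m n → changesUpTo f (m + n) ≡ changesUpTo f m + changesUpTo (f ∘ (m +_)) n
  changesUpTo-+ f zero    n = refl
  changesUpTo-+ f (suc m) n =
    trans (cong (change (f 0) (f 1) +_) (changesUpTo-+ (f ∘ suc) m n)) (sym (+-assoc (change (f 0) (f 1)) _ _))

  changesUpTo-≥1 : ∀ f {i n} → i < n → f i ≢ f (suc i) → 1 ≤ changesUpTo f n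
  changesUpTo-≥1 f {zero}  {suc n} _         f0≢f1 =
    ≤-trans (≤-reflexive (sym (change-≢ f0≢f1))) (m≤m+n _ _)
  changesUpTo-≥1 f {suc i} {suc n} (s≤s i<n) fi≢   =
    ≤-trans (changesUpTo-≥1 (f ∘ suc) i<n fi≢) (m≤n+m _ _)

  changesUpTo-≥2 : ∀ f {i j n} → i < j → j < n →
    f i ≢ f (suc i) → f j ≢ f (suc j) → 2 ≤ changesUpTo f n
  changesUpTo-≥2 f {zero}  {suc j} {suc n} _ (s≤s j<n) f0≢f1 fj≢ =
    subst (λ k → 2 ≤ k + changesUpTo (f ∘ suc) n) (sym (change-≢ f0≢f1))
          (s≤s (changesUpTo-≥1 (f ∘ suc) j<n fj≢))
  changesUpTo-≥2 f {suc i} {suc j} {suc n} (s≤s i<j) (s≤s j<n) fi≢ fj≢ =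
    ≤-trans (changesUpTo-≥2 (f ∘ suc) i<j j<n fi≢ fj≢) (m≤n+m _ _)

  changesUpTo-shift-≥2 : ∀ f a {i j n} → a ≤ i → i < j → j < a + n →
    f i ≢ f (suc i) → f j ≢ f (suc j) → 2 ≤ changesUpTo (f ∘ (a +_)) n
  changesUpTo-shift-≥2 f zero    _ = changesUpTo-≥2 f
  changesUpTo-shift-≥2 f (suc a) {suc i} {suc j} (s≤s a≤i) (s≤s i<j) (s≤s j<n) =
    changesUpTo-shift-≥2 (f ∘ suc) a a≤i i<j j<n

  changesFrom-shortcut : ∀ f J M R {cs₁ cs₂} → All (_≡ f J) cs₁ → All (_≡ f (J + M)) cs₂ →
    2 ≤ changesUpTo (f ∘ (J +_)) M →
    changesFrom (f 0) (applyUpTo f J ++ cs₁ ++ cs₂ ++ applyUpTo (f ∘ (J + M +_)) (suc R))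
      < changesUpTo f (J + M + R)
  changesFrom-shortcut f J M R {cs₁} {cs₂} same₁ same₂ two = begin-strict
    changesFrom (f 0) (applyUpTo f J ++ cs₁ ++ cs₂ ++ applyUpTo g (suc R))
      ≤⟨ changesFrom-detour (f 0) (applyUpTo f J) _ same₁ same₂′ ⟩
    changesFrom (f 0) (applyUpTo f J ++ [ f J ]) + change (f J) (g 0) + changesFrom (g 0) (applyUpTo g (suc R))
      ≡⟨ cong₂ (λ p s → p + change (f J) (g 0) + s) prefix
               (changesFrom-self (g 0) (applyUpTo (g ∘ suc) R)) ⟩
    changesUpTo f J + change (f J) (g 0) + changesUpTo g R
      <⟨ +-monoˡ-< (changesUpTo g R) (+-monoʳ-< (changesUpTo f J) (<-≤-trans (s≤s (change≤1 _ _)) two)) ⟩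
    changesUpTo f J + changesUpTo (f ∘ (J +_)) M + changesUpTo g R
      ≡⟨ trans (changesUpTo-+ f (J + M) R) (cong (_+ changesUpTo g R) (changesUpTo-+ f J M)) ⟨
    changesUpTo f (J + M + R) ∎
    where
      open ≤-Reasoning
      g : ℕ → A
      g = f ∘ (J + M +_)
      same₂′ : All (_≡ g 0) cs₂
      same₂′ = subst (λ c → All (_≡ c) cs₂) (cong f (sym (+-identityʳ (J + M)))) same₂
      prefix : changesFrom (f 0) (applyUpTo f J ++ [ f J ]) ≡ changesUpTo f J
      prefix = trans (cong (changesFrom (f 0)) (applyUpTo-∷ʳ f J))
                     (changesFrom-self (f 0) (applyUpTo (f ∘ suc) J))

  switch? : (f : ℕ → A) → Decidable (λ t → f t ≢ f (suc t))
  switch? f t = ¬? (f t ≟ f (suc t))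

  length-filter-switch-∷ : ∀ f t ts →
    length (filter (switch? f) (t ∷ ts)) ≡ change (f t) (f (suc t)) + length (filter (switch? f) ts)
  length-filter-switch-∷ f t ts with f t ≟ f (suc t)
  ... | yes _ = refl
  ... | no  _ = refl

  length-filter-switch : ∀ f n → length (filter (switch? f) (upTo n)) ≡ changesUpTo f n
  length-filter-switch f zero    = refl
  length-filter-switch f (suc n) = begin
    length (filter (switch? f) (upTo (suc n)))
      ≡⟨ length-filter-switch-∷ f 0 (applyUpTo suc n) ⟩
    change (f 0) (f 1) + length (filter (switch? f) (applyUpTo suc n))
      ≡⟨ cong (λ ts → change (f 0) (f 1) + length (filter (switch? f) ts)) (map-upTo suc n) ⟨
    change (f 0) (f 1) + length (filter (switch? f) (map suc (upTo n)))
      ≡⟨ cong (change (f 0) (f 1) +_) (length-filter-map (switch? f) suc (upTo n)) ⟩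
    change (f 0) (f 1) + length (filter (switch? (f ∘ suc)) (upTo n))
      ≡⟨ cong (change (f 0) (f 1) +_) (length-filter-switch (f ∘ suc) n) ⟩
    changesUpTo f (suc n) ∎
    where open ≡-Reasoning

  changesUpTo-lookupOr : {B : Set} (g : B → A) (d : B) (xs : List B) →
    changesUpTo (g ∘ lookupOr d xs) (length xs ∸ 1) ≡ changes (map g xs)
  changesUpTo-lookupOr g d []       = refl
  changesUpTo-lookupOr g d (x ∷ xs) = cong (changesFrom (g x))
    (trans (sym (map-applyUpTo (lookupOr d xs) g (length xs))) (cong (map g) (applyUpTo-lookupOr d xs)))

module Walks {V E : Set} (_≟_ : DecidableEquality V) (src tgt : E → V) (IsEdge : E → Set) where
  open import Data.List.Membership.DecPropositional _≟_ using (_∈?_)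

  data Walk : V → List E → V → Set where
    []   : ∀ {a} → Walk a [] a
    step : ∀ {a b e es} → IsEdge e → src e ≡ a → Walk (tgt e) es b → Walk a (e ∷ es) b

  _++ʷ_ : ∀ {a b c es es′} → Walk a es b → Walk b es′ c → Walk a (es ++ es′) c
  []                ++ʷ w′ = w′
  step isE src≡ w ++ʷ w′ = step isE src≡ (w ++ʷ w′)

  vertices : V → List E → List V
  vertices a es = a ∷ map tgt es

  StepAt : (ℕ → V) → (ℕ → E) → ℕ → Set
  StepAt u e i = IsEdge (e i) × src (e i) ≡ u i × tgt (e i) ≡ u (suc i)

  walkAlong : ∀ (u : ℕ → V) (e : ℕ → E) a n → (∀ i → i < a + n → StepAt u e i) →
    Walk (u a) (applyUpTo (e ∘ (a +_)) n) (u (a + n))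
  walkAlong u e zero    zero    steps = []
  walkAlong u e zero    (suc n) steps with steps 0 (s≤s z≤n)
  ... | isE , src≡ , tgt≡ = step isE src≡ (subst (λ v → Walk v _ _) (sym tgt≡)
          (walkAlong (u ∘ suc) (e ∘ suc) zero n (λ i i<n → steps (suc i) (s≤s i<n))))
  walkAlong u e (suc a) n       steps = walkAlong (u ∘ suc) (e ∘ suc) a n (λ i i< → steps (suc i) (s≤s i<))

  lookupOr-vertices-last : ∀ d {a b es} → Walk a es b → lookupOr d (vertices a es) (length es) ≡ b
  lookupOr-vertices-last d []           = refl
  lookupOr-vertices-last d (step _ _ w) = lookupOr-vertices-last d w

  walk-steps : ∀ d d′ {a b es} → Walk a es b → ∀ i → i < length es →
    StepAt (lookupOr d (vertices a es)) (lookupOr d′ es) i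
  walk-steps d d′ (step isE src≡ _) zero    _         = isE , src≡ , refl
  walk-steps d d′ (step _ _ w)      (suc i) (s≤s i<n) = walk-steps d d′ w i i<n

  suffixFrom : ∀ {a v b es} → Walk a es b → v ∈ vertices a es →
    Σ (List E) λ es′ → es′ ⊆ es × Walk v es′ b × (Unique (vertices a es) → Unique (vertices v es′))
  suffixFrom w                  (here refl) = _ , ⊆-refl , w , id
  suffixFrom (step {e = e} _ _ w) (there v∈) with suffixFrom w v∈
  ... | es′ , es′⊆ , w′ , unique′ =
    es′ , e ∷ʳ es′⊆ , w′ , λ { (_ ∷ unique) → unique′ unique }

  prune : ∀ {a b es} → Walk a es b →
    Σ (List E) λ es′ → es′ ⊆ es × Walk a es′ b × Unique (vertices a es′)
  prune []                         = [] , [] , [] , [] ∷ []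
  prune {a} (step {e = e} isE src≡ w) with prune w
  ... | es′ , es′⊆ , w′ , unique′ with a ∈? vertices (tgt e) es′
  ...   | no  a∉ = e ∷ es′ , refl ∷ es′⊆ , step isE src≡ w′ , ¬Any⇒All¬ _ a∉ ∷ unique′
  ...   | yes a∈ with suffixFrom w′ a∈
  ...     | es″ , es″⊆ , w″ , unique″ =
    es″ , e ∷ʳ ⊆-trans es″⊆ es′⊆ , w″ , unique″ unique′

module _ {ℓ n m : ℕ} (σ : Fin (suc ℓ) → Permutation′ n) (cl : Point ℓ n → Fin m) (ĉ : Fin m) where
  open Graph σ cl
  open Walks _≟F_ src tgt (IsEdge ĉ)
  open ColourChanges (_≟F_ {suc ℓ})

  reverse : Edge → Edge
  reverse (edge z a k) = edge z a (not k)

  src-reverse : ∀ e → src (reverse e) ≡ tgt e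
  src-reverse (edge z a false) = refl
  src-reverse (edge z a true)  = refl

  tgt-reverse : ∀ e → tgt (reverse e) ≡ src e
  tgt-reverse (edge z a false) = refl
  tgt-reverse (edge z a true)  = refl

  IsEdge-reverse : ∀ e → IsEdge ĉ e → src e ≢ tgt e → IsEdge ĉ (reverse e)
  IsEdge-reverse (edge z a false) (z≢0 , vsrc , vtgt , _) _   = z≢0 , vtgt , vsrc , λ ()
  IsEdge-reverse (edge z a true)  (z≢0 , vsrc , vtgt , _) s≢t = z≢0 , vtgt , vsrc , λ _ → s≢t ∘ sym

  AdjIn-sym : ∀ {z} → Symmetric (AdjIn ĉ z)
  AdjIn-sym (e , isE , colour≡ , ends) = e , isE , colour≡ , swap ends

  walkInComponent : ∀ {z v w} → Star (AdjIn ĉ z) v w →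
    Σ (List Edge) λ es → Walk v es w × All (_≡ z) (map Edge.colour es)
  walkInComponent ε = [] , [] , []
  walkInComponent ((e , isE , colour≡ , inj₁ (src≡ , refl)) ◅ rest) with walkInComponent rest
  ... | es , w , same = e ∷ es , step isE src≡ w , colour≡ ∷ same
  walkInComponent ((e , isE , colour≡ , inj₂ (refl , tgt≡)) ◅ rest)
    with walkInComponent rest | src e ≟F tgt e
  -- the reverse of a loop would be a 0-edge loop, which G_1^* excludes; the step is dropped instead
  ... | es , w , same | yes loop = es , subst (λ v → Walk v es _) (trans loop tgt≡) w , same
  ... | es , w , same | no  s≢t  =
    reverse e ∷ es ,
    step (IsEdge-reverse e isE s≢t) (trans (src-reverse e) tgt≡)
         (subst (λ v → Walk v es _) (sym (tgt-reverse e)) w) ,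
    colour≡ ∷ same

  walk-vertices : ∀ {a b es} → Vertex ĉ a → Walk a es b → All (Vertex ĉ) (vertices a es)
  walk-vertices va []                              = va ∷ []
  walk-vertices va (step (_ , _ , vtgt , _) _ w) = va ∷ walk-vertices vtgt w

  -- e₀ is only the junk value of e beyond the last edge; Edge may be empty, so it is supplied.
  toPath : ∀ {α β es} → Vertex ĉ α → Edge → Walk α es β → Unique (vertices α es) → Path ĉ α β
  toPath {α} {es = es} vα e₀ w unique = record
    { L        = length es
    ; u        = lookupOr α (vertices α es)
    ; e        = lookupOr e₀ es
    ; start    = refl
    ; end      = lookupOr-vertices-last α w
    ; vert     = λ i i≤L → All.lookup (walk-vertices vα w) (lookupOr-∈ (index i≤L))
    ; edges    = walk-steps α e₀ w
    ; distinct = λ i j i≤L j≤L → lookupOr-injective unique (index i≤L) (index j≤L)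
    }
    where
      index : ∀ {i} → i ≤ length es → i < length (vertices α es)
      index i≤L = s≤s (≤-trans i≤L (≤-reflexive (sym (length-map tgt es))))

  switches≡changesUpTo : ∀ {α β} (π : Path ĉ α β) →
    switches ĉ π ≡ changesUpTo (col ĉ π) (Path.L π ∸ 1)
  switches≡changesUpTo π = trans (length-map suc (filter (switch? (col ĉ π)) (upTo (Path.L π ∸ 1))))
                                 (length-filter-switch (col ĉ π) (Path.L π ∸ 1))

  switches-toPath : ∀ {α β es} (vα : Vertex ĉ α) (e₀ : Edge) (w : Walk α es β)
    (unique : Unique (vertices α es)) →
    switches ĉ (toPath vα e₀ w unique) ≡ changes (map Edge.colour es)
  switches-toPath {es = es} vα e₀ w unique =
    trans (switches≡changesUpTo (toPath vα e₀ w unique)) (changesUpTo-lookupOr Edge.colour e₀ es)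

  module _ {α β : Fin m} (π : Path ĉ α β) where
    open Path π

    segment : ∀ a k → a + k ≤ L → Walk (u a) (applyUpTo (e ∘ (a +_)) k) (u (a + k))
    segment a k a+k≤L = walkAlong u e a k (λ i i< → edges i (<-≤-trans i< a+k≤L))

    detour : ∀ J M R {w es₁ es₂} → suc (J + M + R) ≡ L →
      Walk (u J) es₁ w → Walk w es₂ (u (J + M)) →
      Walk α (applyUpTo e J ++ es₁ ++ es₂ ++ applyUpTo (e ∘ (J + M +_)) (suc R)) β
    detour J M R 1+J+M+R≡L walk₁ walk₂ =
      subst (λ v → Walk v _ (u J)) start (segment 0 J J≤L) ++ʷ (walk₁ ++ʷ (walk₂ ++ʷ
      subst (Walk (u (J + M)) _) (trans (cong u J+M+1+R≡L) end)
            (segment (J + M) (suc R) (≤-reflexive J+M+1+R≡L))))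
      where
        J+M+1+R≡L : J + M + suc R ≡ L
        J+M+1+R≡L = trans (+-suc (J + M) R) 1+J+M+R≡L
        J≤L : J ≤ L
        J≤L = ≤-trans (≤-trans (m≤m+n J M) (m≤m+n (J + M) (suc R))) (≤-reflexive J+M+1+R≡L)

    fewerSwitches : ∀ J M R {es₁ es₂ es′} → suc (J + M + R) ≡ L →
      2 ≤ changesUpTo (col ĉ π ∘ (J +_)) M →
      All (_≡ col ĉ π J) (map Edge.colour es₁) → All (_≡ col ĉ π (J + M)) (map Edge.colour es₂) →
      es′ ⊆ applyUpTo e J ++ es₁ ++ es₂ ++ applyUpTo (e ∘ (J + M +_)) (suc R) →
      changes (map Edge.colour es′) < switches ĉ π
    fewerSwitches J M R {es₁} {es₂} {es′} 1+J+M+R≡L two same₁ same₂ es′⊆ = begin-strict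
      changes (map colour es′)
        ≤⟨ changes≤changesFrom (f 0) (map colour es′) ⟩
      changesFrom (f 0) (map colour es′)
        ≤⟨ changesFrom-mono (Sublist.map⁺ colour es′⊆) (f 0) ⟩
      changesFrom (f 0) (map colour (applyUpTo e J ++ es₁ ++ es₂ ++ applyUpTo (e ∘ (J + M +_)) (suc R)))
        ≡⟨ cong (changesFrom (f 0)) colours ⟩
      changesFrom (f 0) (applyUpTo f J ++ map colour es₁ ++ map colour es₂ ++ applyUpTo (f ∘ (J + M +_)) (suc R))
        <⟨ changesFrom-shortcut f J M R same₁ same₂ two ⟩
      changesUpTo f (J + M + R)
        ≡⟨ cong (λ k → changesUpTo f (k ∸ 1)) 1+J+M+R≡L ⟩
      changesUpTo f (L ∸ 1)
        ≡⟨ switches≡changesUpTo π ⟨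
      switches ĉ π ∎
      where
        open ≤-Reasoning
        colour : Edge → Fin (suc ℓ)
        colour = Edge.colour
        f : ℕ → Fin (suc ℓ)
        f = col ĉ π
        colours : map colour (applyUpTo e J ++ es₁ ++ es₂ ++ applyUpTo (e ∘ (J + M +_)) (suc R))
                ≡ applyUpTo f J ++ map colour es₁ ++ map colour es₂ ++ applyUpTo (f ∘ (J + M +_)) (suc R)
        colours =
          trans (map-++ colour (applyUpTo e J) _) (cong₂ _++_ (map-applyUpTo e colour J)
          (trans (map-++ colour es₁ _) (cong (map colour es₁ ++_)
          (trans (map-++ colour es₂ _) (cong (map colour es₂ ++_)
          (map-applyUpTo (e ∘ (J + M +_)) colour (suc R)))))))

    shortcut : ∀ J M R {w} → suc (J + M + R) ≡ L → 2 ≤ changesUpTo (col ĉ π ∘ (J +_)) M →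
      InComp ĉ (u J) (col ĉ π J) w → InComp ĉ (u (J + M)) (col ĉ π (J + M)) w →
      Σ (Path ĉ α β) λ π′ → switches ĉ π′ < switches ĉ π
    shortcut J M R 1+J+M+R≡L two (_ , fromJ) (_ , fromK)
      with walkInComponent fromJ | walkInComponent (Star.reverse AdjIn-sym fromK)
    ... | _ , walk₁ , same₁ | _ , walk₂ , same₂ with prune (detour J M R 1+J+M+R≡L walk₁ walk₂)
    ... | _ , es′⊆ , walk′ , unique′ =
      toPath vα (e 0) walk′ unique′ ,
      subst (_< switches ĉ π) (sym (switches-toPath vα (e 0) walk′ unique′))
            (fewerSwitches J M R 1+J+M+R≡L two same₁ same₂ es′⊆)
      where
        vα : Vertex ĉ α
        vα = subst (Vertex ĉ) start (vert 0 z≤n)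

    switchPositions : List ℕ
    switchPositions = filter (switch? (col ĉ π)) (upTo (L ∸ 1))

    switchPositions-increasing : AllPairs _<_ switchPositions
    switchPositions-increasing =
      AllPairs.filter⁺ (switch? (col ĉ π)) (AllPairs.applyUpTo⁺₁ id (L ∸ 1) (λ i<j _ → i<j))

    ∈-switchPositions : ∀ {t} → t ∈ switchPositions → col ĉ π t ≢ col ĉ π (suc t) × suc t < L
    ∈-switchPositions t∈ with ∈-filter⁻ (switch? (col ĉ π)) t∈
    ... | t∈upTo , switch = switch , <∸1⇒suc< (∈-upTo⁻ t∈upTo)
      where
        <∸1⇒suc< : ∀ {t k} → t < k ∸ 1 → suc t < k
        <∸1⇒suc< {k = suc k} t<k = s≤s t<k

    separated : MinSwitch ĉ π → ∀ {x y} → x + 2 ≤ y → y ≤ switches ĉ π →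
      ¬ (∃[ w ] (InComp ĉ (u (nth (jSeq ĉ π) x)) (col ĉ π (nth (jSeq ĉ π) x)) w
               × InComp ĉ (u (nth (jSeq ĉ π) y)) (col ĉ π (nth (jSeq ĉ π) y)) w))
    separated _ {x} {zero} x+2≤0 _ _ = contradiction (m+n≤o⇒n≤o x x+2≤0) λ ()
    separated minimal {x} {suc y} x+2≤1+y 1+y≤λ (_ , inJ , inK) =
      <⇒≱ (proj₂ shorter) (minimal (proj₁ shorter))
      where
        S : List ℕ
        S = switchPositions
        J K t₁ t₂ : ℕ
        J = nth (jSeq ĉ π) x
        K = nth (jSeq ĉ π) (suc y)
        t₁ = nth S x
        t₂ = nth S y
        y<∣S∣ : y < length S
        y<∣S∣ = subst (y <_) (length-map suc S) 1+y≤λ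
        x<y : x < y
        x<y = ≤-pred (subst (_≤ suc y) (+-comm x 2) x+2≤1+y)
        J≤t₁ : J ≤ t₁
        J≤t₁ = nth-0∷map-suc-++-≤ (L ∷ []) switchPositions-increasing (<-trans x<y y<∣S∣)
        t₁<t₂ : t₁ < t₂
        t₁<t₂ = nth-AllPairs switchPositions-increasing x<y y<∣S∣
        K≡1+t₂ : K ≡ suc t₂
        K≡1+t₂ = nth-map-suc-++ S (L ∷ []) y<∣S∣
        J≤K : J ≤ K
        J≤K = ≤-trans J≤t₁ (≤-trans (<⇒≤ t₁<t₂) (subst (t₂ ≤_) (sym K≡1+t₂) (n≤1+n t₂)))
        K<L : K < L
        K<L = subst (_< L) (sym K≡1+t₂) (proj₂ (∈-switchPositions (nth-∈ y<∣S∣)))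
        J+[K∸J]≡K : J + (K ∸ J) ≡ K
        J+[K∸J]≡K = m+[n∸m]≡n J≤K
        two : 2 ≤ changesUpTo (col ĉ π ∘ (J +_)) (K ∸ J)
        two = changesUpTo-shift-≥2 (col ĉ π) J J≤t₁ t₁<t₂
                (subst (t₂ <_) (sym (trans J+[K∸J]≡K K≡1+t₂)) (n<1+n t₂))
                (proj₁ (∈-switchPositions (nth-∈ (<-trans x<y y<∣S∣))))
                (proj₁ (∈-switchPositions (nth-∈ y<∣S∣)))
        shorter : Σ (Path ĉ α β) λ π′ → switches ĉ π′ < switches ĉ π
        shorter = shortcut J (K ∸ J) (L ∸ suc K)
          (trans (cong (λ k → suc (k + (L ∸ suc K))) J+[K∸J]≡K) (m+[n∸m]≡n K<L)) two inJ
          (subst (λ k → InComp ĉ (u k) (col ĉ π k) _) (sym J+[K∸J]≡K) inK)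

lemma18 : (D : DistanceDomain) (ℓ n k : ℕ) → 2 ≤ suc ℓ → 0 < k →
    (d : Point ℓ n → Point ℓ n → DistanceDomain.Carrier D) → IsMetric D d →
    (σ : Fin (suc ℓ) → Permutation′ n) → IsMinMatching D d σ →
    (C : BalancedClustering {ℓ} {n} k) → IsOptimal D d C →
    let open Graph σ (BalancedClustering.cl C) in
    (ĉ α β : Fin (BalancedClustering.m C)) →
    (π : Path ĉ α β) → MinSwitch ĉ π →
    ∀ (x y : ℕ) → x ≤ switches ĉ π → y ≤ switches ĉ π →
    (x + 2 ≤ y ⊎ y + 2 ≤ x) →
    ¬ (∃[ w ] (InComp ĉ (Path.u π (nth (jSeq ĉ π) x)) (col ĉ π (nth (jSeq ĉ π) x)) w
             × InComp ĉ (Path.u π (nth (jSeq ĉ π) y)) (col ĉ π (nth (jSeq ĉ π) y)) w))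
lemma18 _ _ _ _ _ _ _ _ σ _ C _ ĉ _ _ π minimal _ _ _ y≤λ (inj₁ x+2≤y) =
  separated σ (BalancedClustering.cl C) ĉ π minimal x+2≤y y≤λ
lemma18 _ _ _ _ _ _ _ _ σ _ C _ ĉ _ _ π minimal _ _ x≤λ _ (inj₂ y+2≤x) (w , inX , inY) =
  separated σ (BalancedClustering.cl C) ĉ π minimal y+2≤x x≤λ (w , inY , inX)
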